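{- Let $G$ and $H$ be two nontrivial connected graphs, at least one of which is nonbipartite. Then $diam(G\times H)=2$ if and only if $diam(G)\leq2$, $diam(H)\leq2$, every edge of $G$ is contained in a triangle of $G$, and every edge of $H$ is contained in a triangle of $H$.
   Context: All graphs are simple, finite and undirected; nontrivial means having at least two vertices. The direct product $G\times H$ has vertex set $V(G)\times V(H)$, with $(g,h)$ adjacent to $(g',h')$ iff $gg'\in E(G)$ and $hh'\in E(H)$. -}

module Defs where

open import Data.Nat using (ℕ; zero; suc; _≤_)
open import Data.Fin using (Fin)
open import Data.Bool using (Bool; T)
open import Data.Product using (Σ; ∃; _×_; _,_)
open import Relation.Nullary using (¬_)
open import Relation.Binary.PropositionalEquality using (_≡_; _≢_)

record Graph : Set where
  field
    n     : ℕ
    adj   : Fin n → Fin n → Bool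
    sym   : ∀ u v → adj u v ≡ adj v u
    irref : ∀ u → adj u u ≡ Data.Bool.false

open Graph public

Adj : (G : Graph) → Fin (n G) → Fin (n G) → Set
Adj G u v = T (adj G u v)

data Walk {V : Set} (R : V → V → Set) : V → V → ℕ → Set where
  here : ∀ {u} → Walk R u u zero
  step : ∀ {u w v k} → R u w → Walk R w v k → Walk R u v (suc k)

DistLe : {V : Set} (R : V → V → Set) → V → V → ℕ → Set
DistLe R u v k = Σ ℕ λ m → m ≤ k × Walk R u v m

DiamLe : {V : Set} (R : V → V → Set) → ℕ → Set
DiamLe {V} R k = ∀ (u v : V) → DistLe R u v k

DiamEq2 : {V : Set} (R : V → V → Set) → Set
DiamEq2 R = DiamLe R 2 × ¬ DiamLe R 1

ConnectedRel : {V : Set} (R : V → V → Set) → Set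
ConnectedRel {V} R = ∀ (u v : V) → ∃ λ k → Walk R u v k

Nontrivial : Graph → Set
Nontrivial G = 2 ≤ n G

Connected : Graph → Set
Connected G = ConnectedRel (Adj G)

Diam≤ : Graph → ℕ → Set
Diam≤ G k = DiamLe (Adj G) k

Bipartite : Graph → Set
Bipartite G = Σ (Fin (n G) → Bool) λ c → ∀ u v → Adj G u v → c u ≢ c v

EdgesInTriangles : Graph → Set
EdgesInTriangles G = ∀ u v → Adj G u v → ∃ λ w → Adj G u w × Adj G v w

ProdAdj : (G H : Graph) → (Fin (n G) × Fin (n H)) → (Fin (n G) × Fin (n H)) → Set
ProdAdj G H (g , h) (g' , h') = Adj G g g' × Adj H h h'

-- The direct product has no loops, so two vertices (u , h) and (v , h) with
-- u ~ v are at distance exactly 2; the middle vertex of a 2-walk between them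
-- projects to a common neighbour of u and v in G.  Conversely, if every edge
-- lies in a triangle and the diameter is at most 2, then any two vertices of
-- a nontrivial graph (equal, adjacent or not) have a common neighbour, and
-- common neighbours in both factors combine to one in the product.
module Submission where

open import Defs hiding (sym)
open import Data.Bool using (T)
open import Data.Empty using (⊥-elim)
open import Data.Fin using (Fin; zero; suc; fromℕ<)
open import Data.Nat using (ℕ; zero; suc; _≤_; z≤n; s≤s)
open import Data.Product using (_×_; _,_; proj₁; proj₂; ∃; ∃-syntax; swap)
open import Data.Sum using (_⊎_; inj₁; inj₂)
open import Function using (_∘_)
open import Function.Bundles using (_⇔_; mk⇔)
open import Relation.Nullary using (¬_)
open import Relation.Binary.PropositionalEquality using (_≡_; _≢_; refl; subst; cong)

private variable
  V W : Set
  R : V → V → Set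
  S : W → W → Set
  x y : V
  k : ℕ

CommonNeighbour : (R : V → V → Set) → V → V → Set
CommonNeighbour R x y = ∃[ z ] R x z × R z y

Walk-map : (f : V → W) → (∀ {a b} → R a b → S (f a) (f b)) →
  Walk R x y k → Walk S (f x) (f y) k
Walk-map f hom here       = here
Walk-map f hom (step r w) = step (hom r) (Walk-map f hom w)

CommonNeighbour-map : (f : V → W) → (∀ {a b} → R a b → S (f a) (f b)) →
  CommonNeighbour R x y → CommonNeighbour S (f x) (f y)
CommonNeighbour-map f hom (z , r , s) = f z , hom r , hom s

DistLe-map : (f : V → W) → (∀ {a b} → R a b → S (f a) (f b)) →
  DistLe R x y k → DistLe S (f x) (f y) k
DistLe-map f hom (m , m≤k , w) = m , m≤k , Walk-map f hom w

CommonNeighbour⇒DistLe₂ : CommonNeighbour R x y → DistLe R x y 2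
CommonNeighbour⇒DistLe₂ (z , r , s) = 2 , s≤s (s≤s z≤n) , step r (step s here)

DistLe⇒neighbour : DistLe R x y k → x ≢ y → ∃ (R x)
DistLe⇒neighbour (zero  , _ , here)     x≢x = ⊥-elim (x≢x refl)
DistLe⇒neighbour (suc m , _ , step r _) _   = _ , r

DistLe₁⇒≡⊎R : DistLe R x y 1 → x ≡ y ⊎ R x y
DistLe₁⇒≡⊎R (zero     , _ , here)        = inj₁ refl
DistLe₁⇒≡⊎R (suc zero , _ , step r here) = inj₂ r
DistLe₁⇒≡⊎R (suc (suc _) , s≤s () , _)

DistLe₂-cases : DistLe R x y 2 → x ≡ y ⊎ R x y ⊎ CommonNeighbour R x y
DistLe₂-cases (zero     , _ , here)                 = inj₁ refl
DistLe₂-cases (suc zero , _ , step r here)          = inj₂ (inj₁ r)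
DistLe₂-cases (2        , _ , step r (step s here)) = inj₂ (inj₂ (_ , r , s))
DistLe₂-cases (suc (suc (suc _)) , s≤s (s≤s ()) , _)

DistLe₂⇒CommonNeighbour : DistLe R x y 2 → x ≢ y → ¬ R x y → CommonNeighbour R x y
DistLe₂⇒CommonNeighbour d x≢y ¬Rxy with DistLe₂-cases d
... | inj₁ x≡y        = ⊥-elim (x≢y x≡y)
... | inj₂ (inj₁ Rxy) = ⊥-elim (¬Rxy Rxy)
... | inj₂ (inj₂ c)   = c

∃-≢ : ∀ {n} → 2 ≤ n → (i : Fin n) → ∃ (i ≢_)
∃-≢ (s≤s (s≤s z≤n)) zero    = suc zero , λ ()
∃-≢ (s≤s (s≤s z≤n)) (suc _) = zero , λ ()

module _ (G : Graph) where

  Adj-sym : ∀ {u v} → Adj G u v → Adj G v u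
  Adj-sym {u} {v} = subst T (Graph.sym G u v)

  Adj-irrefl : ∀ {u} → ¬ Adj G u u
  Adj-irrefl {u} = subst T (irref G u)

  Adj⇒≢ : ∀ {u v} → Adj G u v → u ≢ v
  Adj⇒≢ uv refl = Adj-irrefl uv

  CommonNeighbour⇒triangle : ∀ {u v} → CommonNeighbour (Adj G) u v →
    ∃ λ w → Adj G u w × Adj G v w
  CommonNeighbour⇒triangle (w , uw , wv) = w , uw , Adj-sym wv

  CommonNeighbour-all : Nontrivial G → Diam≤ G 2 → EdgesInTriangles G →
    ∀ u v → CommonNeighbour (Adj G) u v
  CommonNeighbour-all nt d t u v with DistLe₂-cases (d u v)
  ... | inj₁ refl =
    let u′ , u≢u′ = ∃-≢ nt u
        w , uw    = DistLe⇒neighbour (d u u′) u≢u′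
    in  w , uw , Adj-sym uw
  ... | inj₂ (inj₁ uv) = let w , uw , vw = t u v uv in w , uw , Adj-sym vw
  ... | inj₂ (inj₂ c)  = c

module _ (G H : Graph) where

  ProdAdj-CommonNeighbour : ∀ {g g′ h h′} →
    CommonNeighbour (Adj G) g g′ → CommonNeighbour (Adj H) h h′ →
    CommonNeighbour (ProdAdj G H) (g , h) (g′ , h′)
  ProdAdj-CommonNeighbour (x , gx , xg′) (y , hy , yh′) = (x , y) , (gx , hy) , (xg′ , yh′)

  ProdAdj-DiamLe-swap : DiamLe (ProdAdj G H) k → DiamLe (ProdAdj H G) k
  ProdAdj-DiamLe-swap d (h , g) (h′ , g′) = DistLe-map swap swap (d (g , h) (g′ , h′))

  ProdAdj-DiamLe⇒Diam≤ˡ : Fin (n H) → DiamLe (ProdAdj G H) k → Diam≤ G k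
  ProdAdj-DiamLe⇒Diam≤ˡ h d u v = DistLe-map proj₁ proj₁ (d (u , h) (v , h))

  ProdAdj-DiamLe₂⇒EdgesInTrianglesˡ : Fin (n H) → DiamLe (ProdAdj G H) 2 → EdgesInTriangles G
  ProdAdj-DiamLe₂⇒EdgesInTrianglesˡ h d u v uv =
    CommonNeighbour⇒triangle G (CommonNeighbour-map {R = ProdAdj G H} {S = Adj G} proj₁ proj₁ common)
    where
    common : CommonNeighbour (ProdAdj G H) (u , h) (v , h)
    common = DistLe₂⇒CommonNeighbour (d (u , h) (v , h))
      (Adj⇒≢ G uv ∘ cong proj₁) (Adj-irrefl H ∘ proj₂)

  ProdAdj-¬DiamLe₁ : Fin (n G) → Nontrivial H → ¬ DiamLe (ProdAdj G H) 1
  ProdAdj-¬DiamLe₁ g ntH d with ∃-≢ ntH (fromℕ< ntH)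
  ... | h′ , h≢h′ with DistLe₁⇒≡⊎R (d (g , fromℕ< ntH) (g , h′))
  ...   | inj₁ eq       = h≢h′ (cong proj₂ eq)
  ...   | inj₂ (gg , _) = Adj-irrefl G gg

lemma6p2 : (G H : Graph) → Nontrivial G → Nontrivial H → Connected G → Connected H →
    (¬ Bipartite G ⊎ ¬ Bipartite H) →
    (DiamEq2 (ProdAdj G H) ⇔ (Diam≤ G 2 × Diam≤ H 2 × EdgesInTriangles G × EdgesInTriangles H))
lemma6p2 G H ntG ntH _ _ _ = mk⇔ to from
  where
  g₀ = fromℕ< ntG
  h₀ = fromℕ< ntH

  to : DiamEq2 (ProdAdj G H) → Diam≤ G 2 × Diam≤ H 2 × EdgesInTriangles G × EdgesInTriangles H
  to (d , _) = ProdAdj-DiamLe⇒Diam≤ˡ G H h₀ d , ProdAdj-DiamLe⇒Diam≤ˡ H G g₀ d′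
             , ProdAdj-DiamLe₂⇒EdgesInTrianglesˡ G H h₀ d
             , ProdAdj-DiamLe₂⇒EdgesInTrianglesˡ H G g₀ d′
    where d′ = ProdAdj-DiamLe-swap G H d

  from : Diam≤ G 2 × Diam≤ H 2 × EdgesInTriangles G × EdgesInTriangles H → DiamEq2 (ProdAdj G H)
  from (dG , dH , tG , tH) = diam≤2 , ProdAdj-¬DiamLe₁ G H g₀ ntH
    where
    diam≤2 : DiamLe (ProdAdj G H) 2
    diam≤2 (g , h) (g′ , h′) = CommonNeighbour⇒DistLe₂ (ProdAdj-CommonNeighbour G H
      (CommonNeighbour-all G ntG dG tG g g′) (CommonNeighbour-all H ntH dH tH h h′))
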